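{- Let $m\ge 1$ and $r\ge 1$ be integers and let $G$ be a graph with exactly $m$ edges and maximum degree at most $r$. If every cluster $T$ of $G$ satisfies $|T|\le r/2$, then fewer than half of the edges of $G$ are tight.
   Context: For a graph $G$ of maximum degree at most $r$, a nonempty clique $T\subseteq V(G)$ is tight if the set $N(T)$ of common neighbours of all vertices of $T$ has size $r+1-|T|$; a cluster is an inclusion-maximal tight clique. An edge is tight if, viewed as a $2$-vertex clique, it is tight. -}

module Defs where

open import Data.Nat using (ℕ; zero; suc; _+_; _≡ᵇ_)
open import Data.Bool using (Bool; true; false; _∧_; _∨_; not; if_then_else_)
open import Data.Fin using (Fin; zero; suc; _<?_; _≟_)
open import Data.Fin.Subset using (Subset; _⊆_; ∣_∣; Nonempty)
open import Data.Vec using (lookup; tabulate)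
open import Relation.Nullary.Decidable using (⌊_⌋)
open import Relation.Binary.PropositionalEquality using (_≡_)

allFin : {n : ℕ} → (Fin n → Bool) → Bool
allFin {zero}  f = true
allFin {suc n} f = f zero ∧ allFin (λ i → f (suc i))

sumFin : {n : ℕ} → (Fin n → ℕ) → ℕ
sumFin {zero}  f = 0
sumFin {suc n} f = f zero + sumFin (λ i → f (suc i))

countFin : {n : ℕ} → (Fin n → Bool) → ℕ
countFin f = sumFin (λ i → if f i then 1 else 0)

record Graph (n : ℕ) : Set where
  field
    adj    : Fin n → Fin n → Bool
    sym    : ∀ u v → adj u v ≡ adj v u
    irrefl : ∀ v → adj v v ≡ false
open Graph public

mem : {n : ℕ} → Subset n → Fin n → Bool
mem T v = lookup T v

module _ {n : ℕ} (G : Graph n) where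

  degree : Fin n → ℕ
  degree v = countFin (λ u → adj G v u)

  MaxDegreeAtMost : ℕ → Set
  MaxDegreeAtMost r = ∀ v → degree v Data.Nat.≤ r

  edgeCount : ℕ
  edgeCount = sumFin (λ i → countFin (λ j → ⌊ i <? j ⌋ ∧ adj G i j))

  isClique : Subset n → Bool
  isClique T = allFin (λ u → allFin (λ v →
    not (mem T u ∧ mem T v ∧ not ⌊ u ≟ v ⌋) ∨ adj G u v))

  commonNbrs : Subset n → Subset n
  commonNbrs T = tabulate (λ w → allFin (λ t → not (mem T t) ∨ adj G t w))

  -- tightness (w.r.t. the degree bound r): nonempty clique T with
  -- |N(T)| = r + 1 - |T|, written additively as |N(T)| + |T| = r + 1
  isTight : ℕ → Subset n → Bool
  isTight r T = not (∣ T ∣ ≡ᵇ 0) ∧ isClique T ∧ ((∣ commonNbrs T ∣ + ∣ T ∣) ≡ᵇ suc r)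

  Tight : ℕ → Subset n → Set
  Tight r T = isTight r T ≡ true

  Cluster : ℕ → Subset n → Set
  Cluster r T = Tight r T × (∀ T′ → T ⊆ T′ → Tight r T′ → T′ ≡ T)
    where open import Data.Product using (_×_)

  pair : Fin n → Fin n → Subset n
  pair i j = tabulate (λ v → ⌊ v ≟ i ⌋ ∨ ⌊ v ≟ j ⌋)

  tightEdgeCount : ℕ → ℕ
  tightEdgeCount r = sumFin (λ i → countFin (λ j →
    ⌊ i <? j ⌋ ∧ adj G i j ∧ isTight r (pair i j)))

module Submission where

-- Let G have maximum degree at most r.
--  * A tight edge vu has |N(vu)| ≥ r - 1, and N(vu) ∪ {u} ⊆ N(v).  Since
--    deg v ≤ r this forces deg v = r and N(v) = N(vu) ∪ {u}: every
--    neighbour of v other than u is a neighbour of u.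
--  * Fix v with t ≥ 1 tight edges and s non-tight edges.  By the previous
--    point the star C = {v} ∪ {tight neighbours of v} is a clique whose
--    common neighbourhood is N(v) ∖ C, so |N(C)| + |C| = deg v + 1 = r + 1
--    and C is tight.  C lies in a cluster K, hence 2(t + 1) ≤ 2|K| ≤ r = t + s.
--    So at every vertex t = 0 or t < s.
--  * Summing over v counts every edge twice, so the numbers T and N of
--    tight and non-tight edges satisfy T = 0 or T < N; as T + N = m ≥ 1,
--    2T < m.

open import Defs hiding (sym)
open import Data.Nat using (ℕ; zero; suc; _+_; _*_; _≤_; _<_; _≡ᵇ_; z≤n; s≤s)
open import Data.Nat.Properties
  using ( +-identityʳ; +-suc; +-comm; +-commutativeSemigroup; ≤-refl; ≤-reflexive
        ; ≤-trans; ≤-antisym; ≤-<-trans; ≤-pred; ≤⇒≯; n≤1+n; 1+n≢0; m≤m+n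
        ; +-mono-≤; +-monoˡ-≤; +-monoʳ-≤; +-monoʳ-<; +-mono-<-≤; +-mono-≤-<; +-mono-<
        ; +-cancelˡ-≤; *-monoʳ-≤; *-cancelˡ-<; m+n≡0⇒m≡0; ≡ᵇ⇒≡; ≡⇒≡ᵇ
        ; module ≤-Reasoning )
open import Algebra.Properties.CommutativeSemigroup +-commutativeSemigroup
  using (interchange)
open import Data.Bool using (Bool; true; false; _∧_; _∨_; not; if_then_else_)
open import Data.Bool.Properties
  using (∧-conicalˡ; ∧-conicalʳ; ∧-assoc; ∧-comm; ∧-zeroʳ; ∧-identityʳ; ∨-comm; ¬-not; T-≡)
import Data.Bool.Properties as Bool
open import Data.Fin using (Fin; zero; suc; _≟_; _<?_)
open import Data.Fin.Properties using (<-cmp)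
open import Data.Fin.Subset using (Subset; ∣_∣; _⊆_; _⊂_)
open import Data.Fin.Subset.Properties
  using (_∈?_; _⊂?_; anySubset?; ⊆-refl; ⊆-trans; ⊆-antisym; ∣p∣≤n
        ; p⊆q⇒∣p∣≤∣q∣; p⊂q⇒∣p∣<∣q∣)
open import Data.Vec using ([]; _∷_; tabulate)
open import Data.Vec.Properties using (lookup∘tabulate; tabulate-cong)
open import Data.Product using (∃; ∃-syntax; _×_; _,_; proj₁)
open import Data.Sum using (_⊎_; inj₁; inj₂)
import Data.Sum as Sum
open import Data.Empty using (⊥; ⊥-elim)
open import Function.Bundles using (Equivalence)
open import Relation.Binary.Definitions using (tri<; tri≈; tri>)
open import Relation.Binary.PropositionalEquality
  using (_≡_; _≢_; refl; sym; trans; cong; cong₂; subst₂; module ≡-Reasoning)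
open import Relation.Nullary using (¬_; Dec; yes; no)
open import Relation.Nullary.Decidable using (⌊_⌋; _×-dec_)
open import Relation.Unary using (Decidable)

∧-elimˡ : ∀ {a b} → a ∧ b ≡ true → a ≡ true
∧-elimˡ {a} {b} = ∧-conicalˡ a b

∧-elimʳ : ∀ {a b} → a ∧ b ≡ true → b ≡ true
∧-elimʳ {a} {b} = ∧-conicalʳ a b

∧-intro : ∀ {a b} → a ≡ true → b ≡ true → a ∧ b ≡ true
∧-intro refl refl = refl

∨-elim : ∀ {a b} → a ∨ b ≡ true → a ≡ true ⊎ b ≡ true
∨-elim {true}  _ = inj₁ refl
∨-elim {false} e = inj₂ e

∨-introˡ : ∀ {a b} → a ≡ true → a ∨ b ≡ true
∨-introˡ refl = refl

∨-introʳ : ∀ {a b} → b ≡ true → a ∨ b ≡ true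
∨-introʳ {true}  _ = refl
∨-introʳ {false} e = e

⇒-intro : ∀ {a b} → (a ≡ true → b ≡ true) → not a ∨ b ≡ true
⇒-intro {false} _ = refl
⇒-intro {true}  h = h refl

⇒-elim : ∀ {a b} → not a ∨ b ≡ true → a ≡ true → b ≡ true
⇒-elim e refl = e

not-elim : ∀ {a} → not a ≡ true → a ≡ false
not-elim {false} _ = refl

not-intro : ∀ {a} → a ≡ false → not a ≡ true
not-intro refl = refl

true≢false : ∀ {a} → a ≡ true → a ≡ false → ⊥
true≢false refl ()

¬true⇒false : ∀ {a} → ¬ (a ≡ true) → a ≡ false
¬true⇒false = ¬-not

⌊⌋-sound : ∀ {A : Set} (a? : Dec A) → ⌊ a? ⌋ ≡ true → A
⌊⌋-sound (yes a) _  = a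
⌊⌋-sound (no _)  ()

⌊⌋-true : ∀ {A : Set} (a? : Dec A) → A → ⌊ a? ⌋ ≡ true
⌊⌋-true (yes _) _ = refl
⌊⌋-true (no ¬a) a = ⊥-elim (¬a a)

⌊⌋-false : ∀ {A : Set} (a? : Dec A) → ¬ A → ⌊ a? ⌋ ≡ false
⌊⌋-false (yes a) ¬a = ⊥-elim (¬a a)
⌊⌋-false (no _)  _  = refl

≡ᵇ-sound : ∀ m n → (m ≡ᵇ n) ≡ true → m ≡ n
≡ᵇ-sound m n e = ≡ᵇ⇒≡ m n (Equivalence.from T-≡ e)

≡ᵇ-complete : ∀ m n → m ≡ n → (m ≡ᵇ n) ≡ true
≡ᵇ-complete m n m≡n = Equivalence.to T-≡ (≡⇒≡ᵇ m n m≡n)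

allFin-elim : ∀ {n} (f : Fin n → Bool) → allFin f ≡ true → ∀ i → f i ≡ true
allFin-elim f e zero    = ∧-elimˡ e
allFin-elim f e (suc i) = allFin-elim (λ j → f (suc j)) (∧-elimʳ {f zero} e) i

allFin-intro : ∀ {n} (f : Fin n → Bool) → (∀ i → f i ≡ true) → allFin f ≡ true
allFin-intro {zero}  f h = refl
allFin-intro {suc n} f h = ∧-intro (h zero) (allFin-intro (λ j → f (suc j)) (λ j → h (suc j)))

sumFin-cong : ∀ {n} {f g : Fin n → ℕ} → (∀ i → f i ≡ g i) → sumFin f ≡ sumFin g
sumFin-cong {zero}  e = refl
sumFin-cong {suc n} e = cong₂ _+_ (e zero) (sumFin-cong (λ i → e (suc i)))

sumFin-zero : ∀ n → sumFin {n} (λ _ → 0) ≡ 0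
sumFin-zero zero    = refl
sumFin-zero (suc n) = sumFin-zero n

sumFin-+ : ∀ {n} (f g : Fin n → ℕ) → sumFin (λ i → f i + g i) ≡ sumFin f + sumFin g
sumFin-+ {zero}  f g = refl
sumFin-+ {suc n} f g =
  trans (cong (f zero + g zero +_) (sumFin-+ (λ i → f (suc i)) (λ i → g (suc i))))
        (interchange (f zero) (g zero) (sumFin (λ i → f (suc i))) (sumFin (λ i → g (suc i))))

sumFin-mono : ∀ {n} {f g : Fin n → ℕ} → (∀ i → f i ≤ g i) → sumFin f ≤ sumFin g
sumFin-mono {zero}  le = z≤n
sumFin-mono {suc n} le = +-mono-≤ (le zero) (sumFin-mono (λ i → le (suc i)))

sumFin-mono-< : ∀ {n} {f g : Fin n → ℕ} → (∀ i → f i ≤ g i) →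
  ∀ j → f j < g j → sumFin f < sumFin g
sumFin-mono-< le zero    lt = +-mono-<-≤ lt (sumFin-mono (λ i → le (suc i)))
sumFin-mono-< le (suc j) lt = +-mono-≤-< (le zero) (sumFin-mono-< (λ i → le (suc i)) j lt)

sumFin-swap : ∀ {n k} (f : Fin n → Fin k → ℕ) →
  sumFin (λ i → sumFin (f i)) ≡ sumFin (λ j → sumFin (λ i → f i j))
sumFin-swap {zero}  {k} f = sym (sumFin-zero k)
sumFin-swap {suc n} f =
  trans (cong (sumFin (f zero) +_) (sumFin-swap (λ i → f (suc i))))
        (sym (sumFin-+ (f zero) (λ j → sumFin (λ i → f (suc i) j))))

sumFin-zero-or-less : ∀ {n} (f g : Fin n → ℕ) → (∀ i → f i ≡ 0 ⊎ f i < g i) →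
  sumFin f ≡ 0 ⊎ sumFin f < sumFin g
sumFin-zero-or-less {zero} f g h = inj₁ refl
sumFin-zero-or-less {suc n} f g h
  with h zero | sumFin-zero-or-less (λ i → f (suc i)) (λ i → g (suc i)) (λ i → h (suc i))
... | inj₁ f₀≡0 | inj₁ rest≡0 rewrite f₀≡0 | rest≡0 = inj₁ refl
... | inj₁ f₀≡0 | inj₂ rest<   rewrite f₀≡0 = inj₂ (+-mono-≤-< z≤n rest<)
... | inj₂ f₀<  | inj₁ rest≡0  rewrite rest≡0 = inj₂ (+-mono-<-≤ f₀< z≤n)
... | inj₂ f₀<  | inj₂ rest<   = inj₂ (+-mono-< f₀< rest<)

indicator : Bool → ℕ
indicator b = if b then 1 else 0

indicator-mono : ∀ {a b} → (a ≡ true → b ≡ true) → indicator a ≤ indicator b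
indicator-mono {false} _ = z≤n
indicator-mono {true}  h rewrite h refl = ≤-refl

indicator-< : ∀ {a b} → a ≡ false → b ≡ true → indicator a < indicator b
indicator-< refl refl = s≤s z≤n

indicator-split : ∀ a b → indicator a ≡ indicator (a ∧ b) + indicator (a ∧ not b)
indicator-split false b     = refl
indicator-split true  false = refl
indicator-split true  true  = refl

indicator-∨ : ∀ a b → indicator (a ∨ b) ≤ indicator a + indicator b
indicator-∨ false b     = ≤-refl
indicator-∨ true  false = ≤-refl
indicator-∨ true  true  = s≤s z≤n

countFin-cong : ∀ {n} {f g : Fin n → Bool} → (∀ i → f i ≡ g i) → countFin f ≡ countFin g
countFin-cong e = sumFin-cong (λ i → cong indicator (e i))

countFin-mono : ∀ {n} {f g : Fin n → Bool} → (∀ i → f i ≡ true → g i ≡ true) →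
  countFin f ≤ countFin g
countFin-mono h = sumFin-mono (λ i → indicator-mono (h i))

countFin-mono-< : ∀ {n} {f g : Fin n → Bool} → (∀ i → f i ≡ true → g i ≡ true) →
  ∀ j → g j ≡ true → f j ≡ false → countFin f < countFin g
countFin-mono-< h j gj fj =
  sumFin-mono-< (λ i → indicator-mono (h i)) j (indicator-< fj gj)

countFin-ext : ∀ {n} {f g : Fin n → Bool} → (∀ i → f i ≡ true → g i ≡ true) →
  (∀ i → g i ≡ true → f i ≡ true) → countFin f ≡ countFin g
countFin-ext f⇒g g⇒f = ≤-antisym (countFin-mono f⇒g) (countFin-mono g⇒f)

countFin-split : ∀ {n} (f g : Fin n → Bool) →
  countFin f ≡ countFin (λ i → f i ∧ g i) + countFin (λ i → f i ∧ not (g i))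
countFin-split f g = trans (sumFin-cong (λ i → indicator-split (f i) (g i)))
  (sumFin-+ (λ i → indicator (f i ∧ g i)) (λ i → indicator (f i ∧ not (g i))))

countFin-∨ : ∀ {n} (f g : Fin n → Bool) →
  countFin (λ i → f i ∨ g i) ≤ countFin f + countFin g
countFin-∨ f g = ≤-trans (sumFin-mono (λ i → indicator-∨ (f i) (g i)))
  (≤-reflexive (sumFin-+ (λ i → indicator (f i)) (λ i → indicator (g i))))

countFin-singleton : ∀ {n} (v : Fin n) → countFin (λ x → ⌊ x ≟ v ⌋) ≡ 1
countFin-singleton {suc n} zero    = cong suc (sumFin-zero n)
countFin-singleton {suc n} (suc v) =
  trans (countFin-cong (λ i → suc-≟-suc i)) (countFin-singleton v)
  where
    suc-≟-suc : ∀ i → ⌊ suc i ≟ suc v ⌋ ≡ ⌊ i ≟ v ⌋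
    suc-≟-suc i with i ≟ v
    ... | yes refl = refl
    ... | no _     = refl

countFin-zero-or-witness : ∀ {n} (f : Fin n → Bool) →
  countFin f ≡ 0 ⊎ ∃[ i ] f i ≡ true
countFin-zero-or-witness {zero}  f = inj₁ refl
countFin-zero-or-witness {suc n} f with f zero in f₀
... | true  = inj₂ (zero , f₀)
... | false with countFin-zero-or-witness (λ i → f (suc i))
...   | inj₁ rest≡0     = inj₁ rest≡0
...   | inj₂ (i , f[i]) = inj₂ (suc i , f[i])

∣∣≡countFin : ∀ {n} (p : Subset n) → ∣ p ∣ ≡ countFin (mem p)
∣∣≡countFin []          = refl
∣∣≡countFin (true ∷ p)  = cong suc (∣∣≡countFin p)
∣∣≡countFin (false ∷ p) = ∣∣≡countFin p

∣tabulate∣ : ∀ {n} (f : Fin n → Bool) → ∣ tabulate f ∣ ≡ countFin f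
∣tabulate∣ f = trans (∣∣≡countFin (tabulate f)) (countFin-cong (lookup∘tabulate f))

module MaximalSuperset {n : ℕ} (P : Subset n → Set) (P? : Decidable P) where

  Maximal : Subset n → Set
  Maximal K = P K × (∀ K′ → K ⊆ K′ → P K′ → K′ ≡ K)

  no-proper-superset⇒maximal : ∀ T → P T → ¬ (∃[ T′ ] T ⊂ T′ × P T′) → Maximal T
  no-proper-superset⇒maximal T pT none = pT , λ K′ T⊆K′ pK′ → ⊆-antisym (K′⊆T T⊆K′ pK′) T⊆K′
    where
      K′⊆T : ∀ {K′} → T ⊆ K′ → P K′ → K′ ⊆ T
      K′⊆T {K′} T⊆K′ pK′ {x} x∈K′ with x ∈? T
      ... | yes x∈T = x∈T
      ... | no  x∉T = ⊥-elim (none (K′ , (T⊆K′ , x , x∈K′ , x∉T) , pK′))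

  -- Pass to proper supersets while possible; k bounds how often |T| can grow.
  extend : ∀ k T → n ≤ k + ∣ T ∣ → P T → ∃[ K ] T ⊆ K × Maximal K
  extend k T bound pT with anySubset? (λ T′ → (T ⊂? T′) ×-dec P? T′)
  ... | no none = T , ⊆-refl , no-proper-superset⇒maximal T pT none
  ... | yes (T′ , T⊂T′ , pT′) with k
  ...   | zero = ⊥-elim (≤⇒≯ (∣p∣≤n T′) (≤-<-trans bound (p⊂q⇒∣p∣<∣q∣ T⊂T′)))
  ...   | suc k with extend k T′ bound′ pT′
    where
      bound′ : n ≤ k + ∣ T′ ∣
      bound′ = ≤-trans bound (≤-trans (≤-reflexive (sym (+-suc k ∣ T ∣)))
                                      (+-monoʳ-≤ k (p⊂q⇒∣p∣<∣q∣ T⊂T′)))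
  ...     | K , T′⊆K , maxK = K , ⊆-trans (proj₁ T⊂T′) T′⊆K , maxK

  maximal-superset : ∀ T → P T → ∃[ K ] T ⊆ K × Maximal K
  maximal-superset T = extend n T (m≤m+n n ∣ T ∣)

pairCount : ∀ {n} → (Fin n → Fin n → Bool) → ℕ
pairCount R = sumFin (λ i → countFin (λ j → ⌊ i <? j ⌋ ∧ R i j))

handshake : ∀ {n} (R : Fin n → Fin n → Bool) → (∀ i j → R i j ≡ R j i) →
  (∀ i → R i i ≡ false) → sumFin (λ i → countFin (R i)) ≡ 2 * pairCount R
handshake {n} R symm irrefl = begin
    sumFin (λ i → countFin (R i))
  ≡⟨ sumFin-cong (λ i → countFin-split (R i) (λ j → ⌊ i <? j ⌋)) ⟩
    sumFin (λ i → above i + notAbove i)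
  ≡⟨ sumFin-+ above notAbove ⟩
    sumFin above + sumFin notAbove
  ≡⟨ cong₂ _+_ (sumFin-cong (λ i → countFin-cong (λ j → ∧-comm (R i j) _)))
               (sumFin-cong (λ i → countFin-cong (not-above⇒below i))) ⟩
    pairCount R + sumFin (λ i → countFin (λ j → ⌊ j <? i ⌋ ∧ R i j))
  ≡⟨ cong (pairCount R +_) (sumFin-swap (λ i j → indicator (⌊ j <? i ⌋ ∧ R i j))) ⟩
    pairCount R + sumFin (λ j → countFin (λ i → ⌊ j <? i ⌋ ∧ R i j))
  ≡⟨ cong (pairCount R +_) (sumFin-cong (λ j → countFin-cong (λ i → cong (⌊ j <? i ⌋ ∧_) (symm i j)))) ⟩
    pairCount R + pairCount R
  ≡⟨ cong (pairCount R +_) (sym (+-identityʳ (pairCount R))) ⟩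
    2 * pairCount R ∎
  where
    open ≡-Reasoning
    above notAbove : Fin n → ℕ
    above    i = countFin (λ j → R i j ∧ ⌊ i <? j ⌋)
    notAbove i = countFin (λ j → R i j ∧ not ⌊ i <? j ⌋)
    -- R is irreflexive, so a related j that is not above i lies below i.
    not-above⇒below : ∀ i j → R i j ∧ not ⌊ i <? j ⌋ ≡ ⌊ j <? i ⌋ ∧ R i j
    not-above⇒below i j with <-cmp i j
    ... | tri< i<j _ j≮i rewrite ⌊⌋-true (i <? j) i<j | ⌊⌋-false (j <? i) j≮i = ∧-zeroʳ (R i j)
    ... | tri≈ _ refl _  rewrite irrefl i = sym (∧-zeroʳ _)
    ... | tri> i≮j _ j<i rewrite ⌊⌋-false (i <? j) i≮j | ⌊⌋-true (j <? i) j<i = ∧-identityʳ (R i j)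

module _ {n : ℕ} (G : Graph n) where

  ∈commonNbrs-elim : ∀ T w → mem (commonNbrs G T) w ≡ true →
    ∀ t → mem T t ≡ true → adj G t w ≡ true
  ∈commonNbrs-elim T w e t t∈T =
    ⇒-elim (allFin-elim _ (trans (sym (lookup∘tabulate _ w)) e) t) t∈T

  ∈commonNbrs-intro : ∀ T w → (∀ t → mem T t ≡ true → adj G t w ≡ true) →
    mem (commonNbrs G T) w ≡ true
  ∈commonNbrs-intro T w h = trans (lookup∘tabulate _ w) (allFin-intro _ (λ t → ⇒-intro (h t)))

  clique-intro : ∀ T → (∀ a b → mem T a ≡ true → mem T b ≡ true → a ≢ b → adj G a b ≡ true) →
    isClique G T ≡ true
  clique-intro T h = allFin-intro _ λ a → allFin-intro _ λ b → ⇒-intro λ e →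
    h a b (∧-elimˡ e) (∧-elimˡ (∧-elimʳ {mem T a} e))
      (λ a≡b → true≢false (⌊⌋-true (a ≟ b) a≡b) (not-elim (∧-elimʳ {mem T b} (∧-elimʳ {mem T a} e))))

  tight-size : ∀ r T → Tight G r T → ∣ commonNbrs G T ∣ + ∣ T ∣ ≡ suc r
  tight-size r T e = ≡ᵇ-sound _ _ (∧-elimʳ {isClique G T} (∧-elimʳ {not (∣ T ∣ ≡ᵇ 0)} e))

  tight-intro : ∀ r T → ∣ T ∣ ≢ 0 → isClique G T ≡ true →
    ∣ commonNbrs G T ∣ + ∣ T ∣ ≡ suc r → Tight G r T
  tight-intro r T nonempty clique size =
    ∧-intro (not-intro (¬true⇒false (λ e → nonempty (≡ᵇ-sound _ 0 e))))
            (∧-intro clique (≡ᵇ-complete _ _ size))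

  mem-pair : ∀ v u t → mem (pair G v u) t ≡ (⌊ t ≟ v ⌋ ∨ ⌊ t ≟ u ⌋)
  mem-pair v u t = lookup∘tabulate _ t

  ∣pair∣≤2 : ∀ v u → ∣ pair G v u ∣ ≤ 2
  ∣pair∣≤2 v u = begin
      ∣ pair G v u ∣
    ≡⟨ ∣tabulate∣ (λ t → ⌊ t ≟ v ⌋ ∨ ⌊ t ≟ u ⌋) ⟩
      countFin (λ t → ⌊ t ≟ v ⌋ ∨ ⌊ t ≟ u ⌋)
    ≤⟨ countFin-∨ (λ t → ⌊ t ≟ v ⌋) (λ t → ⌊ t ≟ u ⌋) ⟩
      countFin (λ t → ⌊ t ≟ v ⌋) + countFin (λ t → ⌊ t ≟ u ⌋)
    ≡⟨ cong₂ _+_ (countFin-singleton v) (countFin-singleton u) ⟩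
      2 ∎
    where open ≤-Reasoning

  pair-sym : ∀ v u → pair G v u ≡ pair G u v
  pair-sym v u = tabulate-cong (λ t → ∨-comm ⌊ t ≟ v ⌋ ⌊ t ≟ u ⌋)

-- A tight edge vu forces N(v) = N(vu) ∪ {u}, and hence deg v = r.

module TightEdge {n : ℕ} (G : Graph n) (r : ℕ) (maxdeg : MaxDegreeAtMost G r)
                 (v u : Fin n) (v∼u : adj G v u ≡ true) (tight : Tight G r (pair G v u)) where

  inN[vu] : Fin n → Bool
  inN[vu] w = mem (commonNbrs G (pair G v u)) w

  inN[vu]+u : Fin n → Bool
  inN[vu]+u w = inN[vu] w ∨ ⌊ w ≟ u ⌋

  u≟u : ⌊ u ≟ u ⌋ ≡ true
  u≟u = ⌊⌋-true (u ≟ u) refl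

  N[vu]⊆N[v] : ∀ w → inN[vu] w ≡ true → adj G v w ≡ true
  N[vu]⊆N[v] w e = ∈commonNbrs-elim G (pair G v u) w e v
    (trans (mem-pair G v u v) (∨-introˡ (⌊⌋-true (v ≟ v) refl)))

  N[vu]⊆N[u] : ∀ w → inN[vu] w ≡ true → adj G u w ≡ true
  N[vu]⊆N[u] w e = ∈commonNbrs-elim G (pair G v u) w e u
    (trans (mem-pair G v u u) (∨-introʳ {⌊ u ≟ v ⌋} u≟u))

  N[vu]+u⊆N[v] : ∀ w → inN[vu]+u w ≡ true → adj G v w ≡ true
  N[vu]+u⊆N[v] w e with ∨-elim {inN[vu] w} e
  ... | inj₁ w∈N = N[vu]⊆N[v] w w∈N
  ... | inj₂ w≡u rewrite ⌊⌋-sound (w ≟ u) w≡u = v∼u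

  -- Tightness gives |N(vu)| ≥ r - 1, and u ∉ N(vu), so |N(vu) ∪ {u}| ≥ r.
  r≤∣N[vu]+u∣ : r ≤ countFin inN[vu]+u
  r≤∣N[vu]+u∣ = ≤-pred (begin
      suc r
    ≡⟨ sym (tight-size G r (pair G v u) tight) ⟩
      ∣ commonNbrs G (pair G v u) ∣ + ∣ pair G v u ∣
    ≤⟨ +-mono-≤ (≤-reflexive (∣∣≡countFin (commonNbrs G (pair G v u)))) (∣pair∣≤2 G v u) ⟩
      countFin inN[vu] + 2
    ≡⟨ +-comm _ 2 ⟩
      suc (suc (countFin inN[vu]))
    ≤⟨ s≤s (countFin-mono-< (λ w → ∨-introˡ) u (∨-introʳ {inN[vu] u} u≟u) u∉N[vu]) ⟩
      suc (countFin inN[vu]+u) ∎)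
    where
      open ≤-Reasoning
      u∉N[vu] : inN[vu] u ≡ false
      u∉N[vu] = ¬true⇒false (λ e → true≢false (N[vu]⊆N[u] u e) (irrefl G u))

  degree≡r : degree G v ≡ r
  degree≡r = ≤-antisym (maxdeg v) (≤-trans r≤∣N[vu]+u∣ (countFin-mono N[vu]+u⊆N[v]))

  -- Every other neighbour x of v is adjacent to u: otherwise N(vu) ∪ {u}
  -- would miss x ∈ N(v), giving deg v > r.
  nbr-of-nbr : ∀ x → adj G v x ≡ true → x ≢ u → adj G u x ≡ true
  nbr-of-nbr x v∼x x≢u with adj G u x in u∼x
  ... | true  = refl
  ... | false = ⊥-elim (≤⇒≯ (maxdeg v)
          (≤-<-trans r≤∣N[vu]+u∣ (countFin-mono-< N[vu]+u⊆N[v] x v∼x x∉N[vu]+u)))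
    where
      x∉N[vu]+u : inN[vu]+u x ≡ false
      x∉N[vu]+u = ¬true⇒false λ e → case-∨ (∨-elim {inN[vu] x} e)
        where
          case-∨ : inN[vu] x ≡ true ⊎ ⌊ x ≟ u ⌋ ≡ true → ⊥
          case-∨ (inj₁ x∈N) = true≢false (N[vu]⊆N[u] x x∈N) u∼x
          case-∨ (inj₂ x≡u) = x≢u (⌊⌋-sound (x ≟ u) x≡u)

module _ {n : ℕ} (G : Graph n) (r : ℕ) where

  tightEdge looseEdge : Fin n → Fin n → Bool
  tightEdge v x = adj G v x ∧ isTight G r (pair G v x)
  looseEdge v x = adj G v x ∧ not (isTight G r (pair G v x))

  tightEdge-sym : ∀ v x → tightEdge v x ≡ tightEdge x v
  tightEdge-sym v x = cong₂ _∧_ (Graph.sym G v x) (cong (isTight G r) (pair-sym G v x))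

  looseEdge-sym : ∀ v x → looseEdge v x ≡ looseEdge x v
  looseEdge-sym v x = cong₂ _∧_ (Graph.sym G v x) (cong (λ T → not (isTight G r T)) (pair-sym G v x))

  tightEdge-irrefl : ∀ v → tightEdge v v ≡ false
  tightEdge-irrefl v = cong (_∧ isTight G r (pair G v v)) (irrefl G v)

  looseEdge-irrefl : ∀ v → looseEdge v v ≡ false
  looseEdge-irrefl v = cong (_∧ not (isTight G r (pair G v v))) (irrefl G v)

  degree-split : ∀ v → degree G v ≡ countFin (tightEdge v) + countFin (looseEdge v)
  degree-split v = countFin-split (adj G v) (λ x → isTight G r (pair G v x))

  edge-split : edgeCount G ≡ pairCount tightEdge + pairCount looseEdge
  edge-split = trans (sumFin-cong split-at) (sumFin-+ tightAbove looseAbove)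
    where
      tightAbove looseAbove : Fin n → ℕ
      tightAbove i = countFin (λ j → ⌊ i <? j ⌋ ∧ tightEdge i j)
      looseAbove i = countFin (λ j → ⌊ i <? j ⌋ ∧ looseEdge i j)
      split-at : ∀ i → countFin (λ j → ⌊ i <? j ⌋ ∧ adj G i j) ≡ tightAbove i + looseAbove i
      split-at i = trans (countFin-split (λ j → ⌊ i <? j ⌋ ∧ adj G i j) (λ j → isTight G r (pair G i j)))
        (cong₂ _+_ (countFin-cong (λ j → ∧-assoc ⌊ i <? j ⌋ (adj G i j) _))
                   (countFin-cong (λ j → ∧-assoc ⌊ i <? j ⌋ (adj G i j) _)))

double-suc≤⇒< : ∀ t s → 2 * suc t ≤ t + s → t < s
double-suc≤⇒< t s h = +-cancelˡ-≤ t (suc t) s (begin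
    t + suc t      ≤⟨ +-monoˡ-≤ (suc t) (n≤1+n t) ⟩
    suc t + suc t  ≡⟨ cong (suc t +_) (sym (+-identityʳ (suc t))) ⟩
    2 * suc t      ≤⟨ h ⟩
    t + s          ∎)
  where open ≤-Reasoning

module Star {n : ℕ} (G : Graph n) (r : ℕ) (maxdeg : MaxDegreeAtMost G r)
            (small : (T : Subset n) → Cluster G r T → 2 * ∣ T ∣ ≤ r) (v : Fin n) where

  t : ℕ
  t = countFin (tightEdge G r v)

  inStar : Fin n → Bool
  inStar x = ⌊ x ≟ v ⌋ ∨ tightEdge G r v x

  star : Subset n
  star = tabulate inStar

  outside : Fin n → Bool
  outside w = adj G v w ∧ not (inStar w)

  v∈star : inStar v ≡ true
  v∈star = ∨-introˡ (⌊⌋-true (v ≟ v) refl)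

  tight-nbr : ∀ a → tightEdge G r v a ≡ true → ∀ x → adj G v x ≡ true → x ≢ a → adj G a x ≡ true
  tight-nbr a e = TightEdge.nbr-of-nbr G r maxdeg v a (∧-elimˡ e) (∧-elimʳ {adj G v a} e)

  ∣star∣≡1+t : ∣ star ∣ ≡ suc t
  ∣star∣≡1+t = begin
      ∣ star ∣
    ≡⟨ ∣tabulate∣ inStar ⟩
      countFin inStar
    ≡⟨ countFin-split inStar (λ x → ⌊ x ≟ v ⌋) ⟩
      countFin (λ x → inStar x ∧ ⌊ x ≟ v ⌋) + countFin (λ x → inStar x ∧ not ⌊ x ≟ v ⌋)
    ≡⟨ cong₂ _+_ (trans (countFin-ext (λ x → ∧-elimʳ {inStar x}) (λ x e → ∧-intro (∨-introˡ e) e))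
                        (countFin-singleton v))
                 (countFin-ext other⇒tight tight⇒other) ⟩
      suc t ∎
    where
      open ≡-Reasoning
      other⇒tight : ∀ x → inStar x ∧ not ⌊ x ≟ v ⌋ ≡ true → tightEdge G r v x ≡ true
      other⇒tight x e with ∨-elim {⌊ x ≟ v ⌋} (∧-elimˡ e)
      ... | inj₁ x≡v = ⊥-elim (true≢false x≡v (not-elim (∧-elimʳ {inStar x} e)))
      ... | inj₂ vx  = vx
      tight⇒other : ∀ x → tightEdge G r v x ≡ true → inStar x ∧ not ⌊ x ≟ v ⌋ ≡ true
      tight⇒other x e = ∧-intro (∨-introʳ {⌊ x ≟ v ⌋} e)
        (not-intro (⌊⌋-false (x ≟ v) λ { refl → true≢false e (tightEdge-irrefl G r x) }))

  degree≡t+outside : degree G v ≡ t + countFin outside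
  degree≡t+outside = trans (countFin-split (adj G v) inStar)
    (cong (_+ countFin outside) (countFin-ext inside⇒tight (λ x e → ∧-intro (∧-elimˡ e) (∨-introʳ {⌊ x ≟ v ⌋} e))))
    where
      inside⇒tight : ∀ x → adj G v x ∧ inStar x ≡ true → tightEdge G r v x ≡ true
      inside⇒tight x e with ∨-elim {⌊ x ≟ v ⌋} (∧-elimʳ {adj G v x} e)
      ... | inj₂ vx  = vx
      ... | inj₁ x≡v rewrite ⌊⌋-sound (x ≟ v) x≡v = ⊥-elim (true≢false (∧-elimˡ e) (irrefl G v))

  star-clique : isClique G star ≡ true
  star-clique = clique-intro G star λ a b a∈ b∈ →
    adjacent a b (trans (sym (lookup∘tabulate inStar a)) a∈) (trans (sym (lookup∘tabulate inStar b)) b∈)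
    where
      adjacent : ∀ a b → inStar a ≡ true → inStar b ≡ true → a ≢ b → adj G a b ≡ true
      adjacent a b a∈ b∈ a≢b with ∨-elim {⌊ a ≟ v ⌋} a∈ | ∨-elim {⌊ b ≟ v ⌋} b∈
      ... | inj₁ a≡v | inj₁ b≡v = ⊥-elim (a≢b (trans (⌊⌋-sound (a ≟ v) a≡v) (sym (⌊⌋-sound (b ≟ v) b≡v))))
      ... | inj₁ a≡v | inj₂ vb rewrite ⌊⌋-sound (a ≟ v) a≡v = ∧-elimˡ vb
      ... | inj₂ va  | inj₁ b≡v rewrite ⌊⌋-sound (b ≟ v) b≡v = trans (Graph.sym G a v) (∧-elimˡ va)
      ... | inj₂ va  | inj₂ vb  = tight-nbr a va b (∧-elimˡ vb) (λ b≡a → a≢b (sym b≡a))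

  ∣N[star]∣≡outside : ∣ commonNbrs G star ∣ ≡ countFin outside
  ∣N[star]∣≡outside = trans (∣∣≡countFin (commonNbrs G star)) (countFin-ext N[star]⇒outside outside⇒N[star])
    where
      N[star]⇒outside : ∀ w → mem (commonNbrs G star) w ≡ true → outside w ≡ true
      N[star]⇒outside w e = ∧-intro (∈commonNbrs-elim G star w e v (trans (lookup∘tabulate inStar v) v∈star))
        (not-intro (¬true⇒false λ w∈ → true≢false
          (∈commonNbrs-elim G star w e w (trans (lookup∘tabulate inStar w) w∈)) (irrefl G w)))
      outside⇒N[star] : ∀ w → outside w ≡ true → mem (commonNbrs G star) w ≡ true
      outside⇒N[star] w e = ∈commonNbrs-intro G star w λ s s∈ →
        nbr s (trans (sym (lookup∘tabulate inStar s)) s∈)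
        where
          w∉ : inStar w ≡ false
          w∉ = not-elim (∧-elimʳ {adj G v w} e)
          nbr : ∀ s → inStar s ≡ true → adj G s w ≡ true
          nbr s s∈ with ∨-elim {⌊ s ≟ v ⌋} s∈
          ... | inj₁ s≡v rewrite ⌊⌋-sound (s ≟ v) s≡v = ∧-elimˡ e
          ... | inj₂ vs  = tight-nbr s vs w (∧-elimˡ e) λ { refl → true≢false s∈ w∉ }

  degree≡r : ∀ u → tightEdge G r v u ≡ true → degree G v ≡ r
  degree≡r u e = TightEdge.degree≡r G r maxdeg v u (∧-elimˡ e) (∧-elimʳ {adj G v u} e)

  -- If v has a tight edge then the star is tight:
  -- |N(C)| + |C| = (deg v - t) + (t + 1) = r + 1.
  star-tight : ∀ u → tightEdge G r v u ≡ true → Tight G r star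
  star-tight u e = tight-intro G r star (λ ∣star∣≡0 → 1+n≢0 (trans (sym ∣star∣≡1+t) ∣star∣≡0)) star-clique (begin
      ∣ commonNbrs G star ∣ + ∣ star ∣
    ≡⟨ cong₂ _+_ ∣N[star]∣≡outside ∣star∣≡1+t ⟩
      countFin outside + suc t
    ≡⟨ trans (+-suc _ t) (cong suc (+-comm _ t)) ⟩
      suc (t + countFin outside)
    ≡⟨ cong suc (trans (sym degree≡t+outside) (degree≡r u e)) ⟩
      suc r ∎)
    where open ≡-Reasoning

  -- The local inequality at v: no tight edges, or fewer tight than non-tight
  -- ones, because the star lies in a cluster K with 2(t + 1) ≤ 2|K| ≤ r.
  local-bound : t ≡ 0 ⊎ t < countFin (looseEdge G r v)
  local-bound with countFin-zero-or-witness (tightEdge G r v)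
  ... | inj₁ t≡0     = inj₁ t≡0
  ... | inj₂ (u , e) with MaximalSuperset.maximal-superset (Tight G r) (λ T → isTight G r T Bool.≟ true)
                            star (star-tight u e)
  ...   | K , star⊆K , cluster = inj₂ (double-suc≤⇒< t _ (begin
      2 * suc t
    ≡⟨ cong (2 *_) (sym ∣star∣≡1+t) ⟩
      2 * ∣ star ∣
    ≤⟨ *-monoʳ-≤ 2 (p⊆q⇒∣p∣≤∣q∣ star⊆K) ⟩
      2 * ∣ K ∣
    ≤⟨ small K cluster ⟩
      r
    ≡⟨ trans (sym (degree≡r u e)) (degree-split G r v) ⟩
      t + countFin (looseEdge G r v) ∎))
    where open ≤-Reasoning

tight-vs-loose : ∀ {n} (G : Graph n) (r : ℕ) → MaxDegreeAtMost G r →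
  ((T : Subset n) → Cluster G r T → 2 * ∣ T ∣ ≤ r) →
  pairCount (tightEdge G r) ≡ 0 ⊎ pairCount (tightEdge G r) < pairCount (looseEdge G r)
tight-vs-loose G r maxdeg small =
  Sum.map (λ Σt≡0 → m+n≡0⇒m≡0 _ (trans (sym tight-twice) Σt≡0))
          (λ Σt<Σs → *-cancelˡ-< 2 _ _ (subst₂ _<_ tight-twice loose-twice Σt<Σs))
          (sumFin-zero-or-less (λ v → countFin (tightEdge G r v)) (λ v → countFin (looseEdge G r v))
                               (Star.local-bound G r maxdeg small))
  where
    tight-twice = handshake (tightEdge G r) (tightEdge-sym G r) (tightEdge-irrefl G r)
    loose-twice = handshake (looseEdge G r) (looseEdge-sym G r) (looseEdge-irrefl G r)

fewer-than-half : ∀ {t s m} → t + s ≡ m → 1 ≤ m → t ≡ 0 ⊎ t < s → 2 * t < m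
fewer-than-half _ 1≤m (inj₁ refl) = 1≤m
fewer-than-half {t} {s} refl _ (inj₂ t<s) = begin-strict
    2 * t  ≡⟨ cong (t +_) (+-identityʳ t) ⟩
    t + t  <⟨ +-monoʳ-< t t<s ⟩
    t + s  ∎
  where open ≤-Reasoning

lemma4p6 : (m r n : ℕ) (G : Graph n) → 1 ≤ m → 1 ≤ r →
    edgeCount G ≡ m → MaxDegreeAtMost G r →
    ((T : Subset n) → Cluster G r T → 2 * ∣ T ∣ ≤ r) →
    2 * tightEdgeCount G r < m
lemma4p6 m r n G 1≤m _ edges maxdeg small =
  fewer-than-half (trans (sym (edge-split G r)) edges) 1≤m (tight-vs-loose G r maxdeg small)
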